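{- Let $k$ and $m$ be odd positive integers. Define \[ S(m,k):=1^{mk}+2^{mk}+\cdots+k^{mk},\qquad S'(m,k):=1^{mk}+2^{mk}+\cdots+(k-1)^{mk}. \] Then $S(m,k)\equiv 0\pmod{k^2}$ and $S'(m,k)\equiv 0\pmod{k^2}$. -}

module Defs where

open import Data.Nat using (ℕ; zero; suc; pred; _+_; _*_; _^_)
open import Data.Product using (∃)
open import Relation.Binary.PropositionalEquality using (_≡_)

Odd : ℕ → Set
Odd n = ∃ λ j → n ≡ 2 * j + 1

powSum : ℕ → ℕ → ℕ
powSum e zero    = 0
powSum e (suc n) = powSum e n + suc n ^ e

S : ℕ → ℕ → ℕ
S m k = powSum (m * k) k

S′ : ℕ → ℕ → ℕ
S′ m k = powSum (m * k) (pred k)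

-- Pair each a with k − a.  For odd e = mk the binomial expansion of (k − a)^e modulo k² is
-- −a^e + e·k·a^(e−1), and e·k = m·k² vanishes, so k² ∣ a^e + (k − a)^e.  Summing over
-- 1 ≤ a ≤ k − 1 gives k² ∣ 2·S′(m,k), hence k² ∣ S′(m,k) as k² is odd; finally
-- S(m,k) = S′(m,k) + k^(mk), and k² ∣ k^(mk) since k ∣ mk forces mk ≥ 2 unless k = 1.
module Submission where

open import Defs
open import Data.Nat.Base using (ℕ; zero; suc; pred; NonZero; >-nonZero)
open import Data.Nat.Properties using (m≤n+m)
open import Data.Product using (_×_; _,_; ∃-syntax)
open import Relation.Binary.PropositionalEquality
  using (_≡_; refl; sym; trans; cong; cong₂; subst; subst₂; module ≡-Reasoning)

odd⇒nonZero : ∀ {n} → Odd n → NonZero n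
odd⇒nonZero (j , refl) = >-nonZero (m≤n+m 1 _)

module IntegerPowers where
  import Data.Nat.Base as ℕ
  open import Data.Integer.Base using (ℤ; +_; -_; _+_; _*_; _^_; 0ℤ; 1ℤ)
  open import Data.Integer.Properties using (pos-+; pos-*; ^-distribˡ-+-*; ^-*-assoc)
  open import Data.Integer.Divisibility.Signed using (divides) renaming (_∣_ to _∣ℤ_)
  open import Data.Integer.Tactic.RingSolver using (solve-∀)
  open ≡-Reasoning

  pos-^ : ∀ a n → + (a ℕ.^ n) ≡ (+ a) ^ n
  pos-^ a zero    = refl
  pos-^ a (suc n) = trans (pos-* a (a ℕ.^ n)) (cong (+ a *_) (pos-^ a n))

  pos-^-+-^ : ∀ a b n → + (a ℕ.^ n ℕ.+ b ℕ.^ n) ≡ (+ a) ^ n + (+ b) ^ n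
  pos-^-+-^ a b n = trans (pos-+ (a ℕ.^ n) (b ℕ.^ n)) (cong₂ _+_ (pos-^ a n) (pos-^ b n))

  -‿^-odd : ∀ x {n} → Odd n → (- x) ^ n ≡ - (x ^ n)
  -‿^-odd x (j , refl) = begin
    (- x) ^ (2 ℕ.* j ℕ.+ 1)      ≡⟨ ^-distribˡ-+-* (- x) (2 ℕ.* j) 1 ⟩
    (- x) ^ (2 ℕ.* j) * (- x) ^ 1  ≡⟨ cong (_* (- x) ^ 1) (sym (^-*-assoc (- x) 2 j)) ⟩
    ((- x) ^ 2) ^ j * (- x) ^ 1    ≡⟨ cong (λ y → y ^ j * (- x) ^ 1) (square-neg x) ⟩
    (x ^ 2) ^ j * (- x) ^ 1        ≡⟨ pull-neg ((x ^ 2) ^ j) x ⟩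
    - ((x ^ 2) ^ j * x ^ 1)        ≡⟨ cong (λ y → - (y * x ^ 1)) (^-*-assoc x 2 j) ⟩
    - (x ^ (2 ℕ.* j) * x ^ 1)      ≡⟨ cong -_ (sym (^-distribˡ-+-* x (2 ℕ.* j) 1)) ⟩
    - (x ^ (2 ℕ.* j ℕ.+ 1))        ∎
    where
    square-neg : ∀ x → (- x) * ((- x) * 1ℤ) ≡ x * (x * 1ℤ)
    square-neg = solve-∀
    pull-neg : ∀ y x → y * ((- x) * 1ℤ) ≡ - (y * (x * 1ℤ))
    pull-neg = solve-∀

  binomial-mod-square : ∀ y x n .{{_ : NonZero n}} →
    ∃[ c ] (y + x) ^ n ≡ y ^ n + + n * x * y ^ pred n + x * x * c
  binomial-mod-square y x 1             = 0ℤ , first-power y x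
    where
    first-power : ∀ y x → (y + x) * 1ℤ ≡ y * 1ℤ + 1ℤ * x * 1ℤ + x * x * 0ℤ
    first-power = solve-∀
  binomial-mod-square y x (suc n@(suc _)) with binomial-mod-square y x n
  ... | c , eq = y * c + + n * y ^ pred n + x * c ,
    trans (cong ((y + x) *_) eq) (multiply-out y x (y ^ pred n) (+ n) c)
    where
    multiply-out : ∀ y x p N c → (y + x) * (y * p + N * x * p + x * x * c)
      ≡ y * (y * p) + (1ℤ + N) * x * (y * p) + x * x * (y * c + N * p + x * c)
    multiply-out = solve-∀

  ∣a+b⇒k*k∣a^e+b^e : ∀ {k a b e} → Odd e → k ∣ℤ + e → k ∣ℤ a + b → k * k ∣ℤ a ^ e + b ^ e
  ∣a+b⇒k*k∣a^e+b^e {k} {a} {b} {e} odd-e (divides q e≡qk) (divides t a+b≡tk)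
    with c , expansion ← binomial-mod-square (- a) (t * k) e {{odd⇒nonZero odd-e}} =
    divides (q * t * p + t * t * c) (begin
      a ^ e + b ^ e
        ≡⟨ cong (λ y → a ^ e + y ^ e) (trans (isolate a b) (cong (λ y → - a + y) a+b≡tk)) ⟩
      a ^ e + (- a + t * k) ^ e
        ≡⟨ cong (λ y → a ^ e + y) expansion ⟩
      a ^ e + ((- a) ^ e + + e * (t * k) * p + t * k * (t * k) * c)
        ≡⟨ cong₂ (λ u v → a ^ e + (u + v * (t * k) * p + t * k * (t * k) * c))
             (-‿^-odd a odd-e) e≡qk ⟩
      a ^ e + (- (a ^ e) + q * k * (t * k) * p + t * k * (t * k) * c)
        ≡⟨ cancel (a ^ e) q t k p c ⟩
      (q * t * p + t * t * c) * (k * k) ∎)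
    where
    p = (- a) ^ ℕ.pred e
    isolate : ∀ a b → b ≡ - a + (a + b)
    isolate = solve-∀
    cancel : ∀ A q t k p c → A + (- A + q * k * (t * k) * p + t * k * (t * k) * c)
      ≡ (q * t * p + t * t * c) * (k * k)
    cancel = solve-∀

open IntegerPowers using (pos-^-+-^)

open import Data.Nat.Base using (_+_; _*_; _∸_; _^_; s≤s)
open import Data.Nat.Properties using (+-0-commutativeMonoid; +-suc; m+[n∸m]≡n; *-assoc; *-comm)
open import Data.Nat.Divisibility
  using (_∣_; divides; _∣0; 1∣_; ∣-refl; ∣⇒≤; n∣m*n; ∣n⇒∣m*n; ∣m∣n⇒∣m+n; ∣m+n∣m⇒∣n)
open import Data.Nat.Tactic.RingSolver using (solve)
open import Data.Integer.Base using (+_)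
open import Data.Integer.Properties using (pos-*)
open import Data.Integer.Divisibility.Signed using (∣ᵤ⇒∣; ∣⇒∣ᵤ) renaming (_∣_ to _∣ℤ_)
open import Data.Fin.Base as Fin using (Fin; toℕ; opposite; inject₁; fromℕ)
open import Data.Fin.Properties using (toℕ<n; toℕ-inject₁; toℕ-fromℕ; opposite-prop)
open import Data.Fin.Permutation using (reverse)
open import Data.Vec.Functional using (Vector)
open import Data.List.Base using (_∷_; [])
open import Function.Base using (_∘_)
open import Algebra.Properties.CommutativeMonoid.Sum +-0-commutativeMonoid
  using (sum; sum-syntax; sum-cong-≗; sum-init-last; sum-permute; ∑-distrib-+)

odd-* : ∀ {m n} → Odd m → Odd n → Odd (m * n)
odd-* (a , refl) (b , refl) = 2 * a * b + a + b , solve (a ∷ b ∷ [])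

odd∣x+x⇒∣x : ∀ {d x} → Odd d → d ∣ x + x → d ∣ x
odd∣x+x⇒∣x {x = x} (t , refl) d∣x+x =
  ∣m+n∣m⇒∣n (subst (2 * t + 1 ∣_) x*d≡t*[x+x]+x (n∣m*n x)) (∣n⇒∣m*n t d∣x+x)
  where
  x*d≡t*[x+x]+x : x * (2 * t + 1) ≡ t * (x + x) + x
  x*d≡t*[x+x]+x = solve (x ∷ t ∷ [])

k*k∣k^e : ∀ {k e} .{{_ : NonZero e}} → k ∣ e → k * k ∣ k ^ e
k*k∣k^e {zero}            {suc e} _   = 0 ∣0
k*k∣k^e {suc zero}        {e}     _   = 1∣ _
k*k∣k^e {k@(suc (suc _))} {e}     k∣e with ∣⇒≤ k∣e
... | s≤s (s≤s {n = n} _) = divides (k ^ n) (begin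
  k * (k * k ^ n)  ≡⟨ sym (*-assoc k k (k ^ n)) ⟩
  k * k * k ^ n    ≡⟨ *-comm (k * k) (k ^ n) ⟩
  k ^ n * (k * k)  ∎)
  where open ≡-Reasoning

∣a+b⇒k*k∣a^e+b^e : ∀ {k a b e} → Odd e → k ∣ e → k ∣ a + b → k * k ∣ a ^ e + b ^ e
∣a+b⇒k*k∣a^e+b^e {k} {a} {b} {e} odd-e k∣e k∣a+b =
  ∣⇒∣ᵤ (subst₂ _∣ℤ_ (sym (pos-* k k)) (sym (pos-^-+-^ a b e))
    (IntegerPowers.∣a+b⇒k*k∣a^e+b^e odd-e (∣ᵤ⇒∣ {+ k} {+ e} k∣e) (∣ᵤ⇒∣ {+ k} {+ (a + b)} k∣a+b)))

∑-∣ : ∀ {d n} (f : Vector ℕ n) → (∀ i → d ∣ f i) → d ∣ sum f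
∑-∣ {n = zero}  f _   = _ ∣0
∑-∣ {n = suc n} f d∣f = ∣m∣n⇒∣m+n (d∣f Fin.zero) (∑-∣ (f ∘ Fin.suc) (d∣f ∘ Fin.suc))

powSum≡∑ : ∀ e n → powSum e n ≡ ∑[ i < n ] (suc (toℕ i) ^ e)
powSum≡∑ e zero    = refl
powSum≡∑ e (suc n) = begin
  powSum e n + suc n ^ e
    ≡⟨ cong₂ _+_ (powSum≡∑ e n) (cong (λ j → suc j ^ e) (sym (toℕ-fromℕ n))) ⟩
  ∑[ i < n ] (suc (toℕ i) ^ e) + suc (toℕ (fromℕ n)) ^ e
    ≡⟨ cong (_+ suc (toℕ (fromℕ n)) ^ e)
         (sum-cong-≗ {n} (λ i → cong (λ j → suc j ^ e) (sym (toℕ-inject₁ i)))) ⟩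
  ∑[ i < n ] (suc (toℕ (inject₁ i)) ^ e) + suc (toℕ (fromℕ n)) ^ e
    ≡⟨ sym (sum-init-last (λ i → suc (toℕ i) ^ e)) ⟩
  ∑[ i < suc n ] (suc (toℕ i) ^ e) ∎
  where open ≡-Reasoning

powSum+powSum≡∑ : ∀ e n →
  powSum e n + powSum e n ≡ ∑[ i < n ] (suc (toℕ i) ^ e + suc (toℕ (opposite i)) ^ e)
powSum+powSum≡∑ e n = begin
  powSum e n + powSum e n
    ≡⟨ cong₂ _+_ (powSum≡∑ e n) (trans (powSum≡∑ e n) (sum-permute f reverse)) ⟩
  sum f + sum (f ∘ opposite)
    ≡⟨ sym (∑-distrib-+ f (f ∘ opposite)) ⟩
  ∑[ i < n ] (f i + f (opposite i)) ∎
  where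
  open ≡-Reasoning
  f : Vector ℕ n
  f i = suc (toℕ i) ^ e

suc+suc-opposite : ∀ {n} (i : Fin n) → suc (toℕ i) + suc (toℕ (opposite i)) ≡ suc n
suc+suc-opposite {n} i = begin
  suc (toℕ i) + suc (toℕ (opposite i))  ≡⟨ cong (λ j → suc (toℕ i) + suc j) (opposite-prop i) ⟩
  suc (toℕ i) + suc (n ∸ suc (toℕ i))   ≡⟨ +-suc (suc (toℕ i)) _ ⟩
  suc (suc (toℕ i) + (n ∸ suc (toℕ i))) ≡⟨ cong suc (m+[n∸m]≡n (toℕ<n i)) ⟩
  suc n ∎
  where open ≡-Reasoning

k*k∣powSum-pred : ∀ {k e} → Odd k → Odd e → k ∣ e → k * k ∣ powSum e (pred k)
k*k∣powSum-pred {zero}      _     _     _   = 0 ∣0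
k*k∣powSum-pred {k@(suc n)} {e} odd-k odd-e k∣e = odd∣x+x⇒∣x (odd-* odd-k odd-k)
  (subst (k * k ∣_) (sym (powSum+powSum≡∑ e n)) (∑-∣ _ pair-divisible))
  where
  pair-divisible : ∀ i → k * k ∣ suc (toℕ i) ^ e + suc (toℕ (opposite i)) ^ e
  pair-divisible i = ∣a+b⇒k*k∣a^e+b^e odd-e k∣e (subst (k ∣_) (sym (suc+suc-opposite i)) ∣-refl)

powSum≡powSum-pred+^ : ∀ e k .{{_ : NonZero k}} → powSum e k ≡ powSum e (pred k) + k ^ e
powSum≡powSum-pred+^ e (suc n) = refl

proposition2p7 : (m k : ℕ) → Odd k → Odd m → (k * k ∣ S m k) × (k * k ∣ S′ m k)
proposition2p7 m k odd-k odd-m = S-divisible , S′-divisible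
  where
  odd-mk : Odd (m * k)
  odd-mk = odd-* odd-m odd-k
  k∣mk : k ∣ m * k
  k∣mk = n∣m*n m
  S′-divisible : k * k ∣ S′ m k
  S′-divisible = k*k∣powSum-pred odd-k odd-mk k∣mk
  S-divisible : k * k ∣ S m k
  S-divisible = subst (k * k ∣_) (sym (powSum≡powSum-pred+^ (m * k) k {{odd⇒nonZero odd-k}}))
    (∣m∣n⇒∣m+n S′-divisible (k*k∣k^e {{odd⇒nonZero odd-mk}} k∣mk))
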